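{- A clause $c$ of a CNF formula $F$ is superredundant in $F$ if and only if $(F \setminus \{c\}) \cup \mathrm{resolve}(c,F) \models c$.
   Context: A CNF formula is a finite set of clauses; a clause is a finite set of literals, read as their disjunction. Tautological clauses are not allowed. Resolution: from clauses $c_1 \vee l$ and $c_2 \vee \neg l$ derive $c_1 \vee c_2$; two clauses whose resolvent would be a tautology are considered not to resolve. $\mathrm{resolve}(c,F)$ is the set of all clauses obtained by a single resolution step between $c$ and some clause of $F$. The resolution closure $\mathrm{ResCn}(F)$ is the set of all clauses obtainable from $F$ by zero or more resolution steps. A clause $c \in F$ is superredundant in $F$ if $\mathrm{ResCn}(F) \setminus \{c\} \models c$. -}

module Defs where

open import Data.Nat using (ℕ)
open import Data.Bool using (Bool; true; false; not)
open import Data.Product using (Σ; ∃; _×_; _,_)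
open import Data.Sum using (_⊎_)
open import Data.List using (List)
open import Data.List.Membership.Propositional using (_∈_; _∉_)
open import Data.List.Relation.Unary.Any using (Any)
open import Data.List.Relation.Binary.Subset.Propositional using (_⊆_)
open import Relation.Binary.PropositionalEquality using (_≡_; _≢_)
open import Relation.Nullary using (¬_)
open import Function.Bundles using (_⇔_)

-- A literal: a variable (ℕ) together with a polarity (true = positive).
Lit : Set
Lit = ℕ × Bool

neg : Lit → Lit
neg (x , b) = (x , not b)

-- A clause is a finite set of literals, represented by a list read as a set
-- (order and multiplicity irrelevant; clause identity is set equality _≈_).
Clause : Set
Clause = List Lit

_≈_ : Clause → Clause → Set
c ≈ d = (c ⊆ d) × (d ⊆ c)

NonTaut : Clause → Set
NonTaut c = ∀ l → l ∈ c → neg l ∉ c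

Formula : Set
Formula = List Clause

WF : Formula → Set
WF F = ∀ c → c ∈ F → NonTaut c

ClauseSet : Set₁
ClauseSet = Clause → Set

_∈F_ : Clause → Formula → Set
c ∈F F = Σ Clause λ d → d ∈ F × d ≈ c

Assignment : Set
Assignment = ℕ → Bool

evalLit : Assignment → Lit → Bool
evalLit a (x , true)  = a x
evalLit a (x , false) = not (a x)

Sat : Assignment → Clause → Set
Sat a c = Any (λ l → evalLit a l ≡ true) c

_⊨_ : ClauseSet → Clause → Set
S ⊨ c = ∀ (a : Assignment) → (∀ d → S d → Sat a d) → Sat a c

-- r is the resolvent of c₁ ∨ l and c₂ ∨ ¬l (on literal l ∈ c₁, neg l ∈ c₂),
-- r = (c₁ ∖ {l}) ∪ (c₂ ∖ {¬l}); clauses whose resolvent would be tautological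
-- do not resolve.
Resolvent : Clause → Clause → Clause → Set
Resolvent c₁ c₂ r =
  Σ Lit λ l → (l ∈ c₁) × (neg l ∈ c₂)
    × (∀ x → (x ∈ r) ⇔ (((x ∈ c₁) × (x ≢ l)) ⊎ ((x ∈ c₂) × (x ≢ neg l))))
    × NonTaut r

resolve : Clause → Formula → ClauseSet
resolve c F r = Σ Clause λ d → (d ∈F F) × Resolvent c d r

data ResCn (F : Formula) : ClauseSet where
  base : ∀ {c} → c ∈F F → ResCn F c
  step : ∀ {c₁ c₂ r} → ResCn F c₁ → ResCn F c₂ → Resolvent c₁ c₂ r → ResCn F r

_∖｛_｝ : ClauseSet → Clause → ClauseSet
(S ∖｛ c ｝) d = S d × ¬ (d ≈ c)

_∪_ : ClauseSet → ClauseSet → ClauseSet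
(S ∪ T) d = S d ⊎ T d

asSet : Formula → ClauseSet
asSet F d = d ∈F F

Superredundant : Formula → Clause → Set
Superredundant F c = (ResCn F ∖｛ c ｝) ⊨ c

-- Resolvents of c with clauses of F lie in ResCn(F) ∖ {c}, which gives "⇐".
-- For "⇒", let a satisfy (F ∖ {c}) ∪ resolve(c, F) but falsify c.  By induction
-- on derivations, every clause r ≠ c of ResCn(F) is satisfied by a even after
-- deleting any one literal ¬l with l ∈ c.  For r ∈ F, if deleting ¬l left r
-- unsatisfied, then ¬l is the only true literal of r; as every ¬l′ with l′ ∈ c is
-- true, the resolvent of c and r on l is not a tautology, so it is satisfied by a,
-- and its true literal must come from r.  For a resolution step, one of the pivots
-- l, ¬l is false, and all true literals of the premise containing it survive.
module Submission where

open import Defs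
open import Data.Bool using (true; false; not)
open import Data.Bool.Properties using (not-involutive; not-¬; ¬-not)
import Data.Bool as Bool
open import Data.Empty using (⊥-elim)
open import Data.List using (filter; _++_)
open import Data.List.Membership.Propositional using (_∈_; _∉_; find; lose)
open import Data.List.Membership.Propositional.Properties
  using (∈-filter⁺; ∈-filter⁻; ∈-++⁺ˡ; ∈-++⁺ʳ; ∈-++⁻)
open import Data.List.Relation.Unary.Any using (Any; any?)
open import Data.List.Relation.Unary.All as All using (all?)
open import Data.List.Relation.Binary.Subset.Propositional using (_⊆_)
import Data.Nat as ℕ
open import Data.Product using (_×_; _,_; proj₁; proj₂)
open import Data.Product.Properties using (≡-dec)
open import Data.Sum using (_⊎_; inj₁; inj₂)
open import Function.Bundles using (_⇔_; mk⇔; Equivalence)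
open import Relation.Binary.Definitions using (DecidableEquality; Decidable)
open import Relation.Binary.PropositionalEquality using (_≡_; _≢_; refl; sym; trans; cong; subst)
open import Relation.Nullary using (¬_; Dec; yes; no)
open import Relation.Nullary.Decidable using (¬?; _×-dec_)

_≟ˡ_ : DecidableEquality Lit
_≟ˡ_ = ≡-dec ℕ._≟_ Bool._≟_

open import Data.List.Membership.DecPropositional _≟ˡ_ using (_∈?_)

_⊆?_ : (c d : Clause) → Dec (c ⊆ d)
c ⊆? d with all? (_∈? d) c
... | yes c⊆d = yes (All.lookup c⊆d)
... | no c⊈d  = no (λ c⊆d → c⊈d (All.tabulate c⊆d))

_≈?_ : Decidable _≈_
c ≈? d with c ⊆? d | d ⊆? c
... | yes c⊆d | yes d⊆c = yes (c⊆d , d⊆c)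
... | no c⊈d  | _       = no (λ c≈d → c⊈d (proj₁ c≈d))
... | _       | no d⊈c  = no (λ c≈d → d⊈c (proj₂ c≈d))

neg-involutive : ∀ l → neg (neg l) ≡ l
neg-involutive (x , b) = cong (x ,_) (not-involutive b)

NonTaut-resp-≈ : ∀ {c d} → c ≈ d → NonTaut c → NonTaut d
NonTaut-resp-≈ (_ , d⊆c) ntc l l∈d ¬l∈d = ntc l (d⊆c l∈d) (d⊆c ¬l∈d)

NonTaut-∈F : ∀ {F c} → WF F → c ∈F F → NonTaut c
NonTaut-∈F wf (d , d∈F , d≈c) = NonTaut-resp-≈ d≈c (wf d d∈F)

Any-transport : ∀ {P Q : Lit → Set} {c d : Clause} →
                (∀ {m} → m ∈ c → P m → m ∈ d × Q m) → Any P c → Any Q d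
Any-transport f p with find p
... | m , m∈c , pm = let m∈d , qm = f m∈c pm in lose m∈d qm

Holds : Assignment → Lit → Set
Holds a l = evalLit a l ≡ true

holds? : ∀ a l → Dec (Holds a l)
holds? a l = evalLit a l Bool.≟ true

evalLit-neg : ∀ a l → evalLit a (neg l) ≡ not (evalLit a l)
evalLit-neg a (x , true)  = refl
evalLit-neg a (x , false) = sym (not-involutive (a x))

¬holds⇒holds-neg : ∀ {a} l → ¬ Holds a l → Holds a (neg l)
¬holds⇒holds-neg {a} l ¬h = trans (evalLit-neg a l) (cong not (¬-not ¬h))

¬holds-neg⇒holds : ∀ {a} l → ¬ Holds a (neg l) → Holds a l
¬holds-neg⇒holds {a} l ¬h =
  subst (Holds a) (neg-involutive l) (¬holds⇒holds-neg (neg l) ¬h)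

holds⇒¬holds-neg : ∀ {a} l → Holds a l → ¬ Holds a (neg l)
holds⇒¬holds-neg {a} l h h¬ = not-¬ (sym h) (sym (trans (sym (evalLit-neg a l)) h¬))

SatExcept : Assignment → Lit → Clause → Set
SatExcept a x c = Any (λ m → m ≢ x × Holds a m) c

satExcept? : ∀ a x c → Dec (SatExcept a x c)
satExcept? a x c = any? (λ m → ¬? (m ≟ˡ x) ×-dec holds? a m) c

module _ {c₁ c₂ r : Clause} where

  pivot : Resolvent c₁ c₂ r → Lit
  pivot = proj₁

  ∈-resolventˡ : (res : Resolvent c₁ c₂ r) → ∀ {x} → x ∈ c₁ → x ≢ pivot res → x ∈ r
  ∈-resolventˡ (_ , _ , _ , ch , _) x∈c₁ x≢l = Equivalence.from (ch _) (inj₁ (x∈c₁ , x≢l))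

  ∈-resolventʳ : (res : Resolvent c₁ c₂ r) → ∀ {x} → x ∈ c₂ → x ≢ neg (pivot res) → x ∈ r
  ∈-resolventʳ (_ , _ , _ , ch , _) x∈c₂ x≢¬l = Equivalence.from (ch _) (inj₂ (x∈c₂ , x≢¬l))

  pivot∉resolvent : NonTaut c₂ → (res : Resolvent c₁ c₂ r) → pivot res ∉ r
  pivot∉resolvent ntc₂ (l , _ , ¬l∈c₂ , ch , _) l∈r with Equivalence.to (ch l) l∈r
  ... | inj₁ (_ , l≢l)  = l≢l refl
  ... | inj₂ (l∈c₂ , _) = ntc₂ l l∈c₂ ¬l∈c₂

  resolvent-sym : Resolvent c₁ c₂ r → Resolvent c₂ c₁ r
  resolvent-sym (l , l∈c₁ , ¬l∈c₂ , ch , ntr) =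
    neg l , ¬l∈c₂ , subst (_∈ c₁) (sym (neg-involutive l)) l∈c₁ , ch′ , ntr
    where
    ch′ : ∀ x → (x ∈ r) ⇔ (((x ∈ c₂) × (x ≢ neg l)) ⊎ ((x ∈ c₁) × (x ≢ neg (neg l))))
    ch′ x = mk⇔ to from
      where
      to : x ∈ r → ((x ∈ c₂) × (x ≢ neg l)) ⊎ ((x ∈ c₁) × (x ≢ neg (neg l)))
      to x∈r with Equivalence.to (ch x) x∈r
      ... | inj₁ (x∈c₁ , x≢l)  = inj₂ (x∈c₁ , λ e → x≢l (trans e (neg-involutive l)))
      ... | inj₂ (x∈c₂ , x≢¬l) = inj₁ (x∈c₂ , x≢¬l)
      from : ((x ∈ c₂) × (x ≢ neg l)) ⊎ ((x ∈ c₁) × (x ≢ neg (neg l))) → x ∈ r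
      from (inj₁ (x∈c₂ , x≢¬l))  = Equivalence.from (ch x) (inj₂ (x∈c₂ , x≢¬l))
      from (inj₂ (x∈c₁ , x≢¬¬l)) =
        Equivalence.from (ch x) (inj₁ (x∈c₁ , λ e → x≢¬¬l (trans e (sym (neg-involutive l)))))

resolventOn : Lit → Clause → Clause → Clause
resolventOn l c₁ c₂ = filter (λ x → ¬? (x ≟ˡ l)) c₁ ++ filter (λ x → ¬? (x ≟ˡ neg l)) c₂

∈-resolventOn : ∀ l c₁ c₂ x →
                (x ∈ resolventOn l c₁ c₂) ⇔ (((x ∈ c₁) × (x ≢ l)) ⊎ ((x ∈ c₂) × (x ≢ neg l)))
∈-resolventOn l c₁ c₂ x = mk⇔ to from
  where
  to : x ∈ resolventOn l c₁ c₂ → ((x ∈ c₁) × (x ≢ l)) ⊎ ((x ∈ c₂) × (x ≢ neg l))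
  to x∈ with ∈-++⁻ (filter (λ x → ¬? (x ≟ˡ l)) c₁) x∈
  ... | inj₁ p = inj₁ (∈-filter⁻ (λ x → ¬? (x ≟ˡ l)) p)
  ... | inj₂ p = inj₂ (∈-filter⁻ (λ x → ¬? (x ≟ˡ neg l)) p)
  from : ((x ∈ c₁) × (x ≢ l)) ⊎ ((x ∈ c₂) × (x ≢ neg l)) → x ∈ resolventOn l c₁ c₂
  from (inj₁ (x∈c₁ , x≢l))  = ∈-++⁺ˡ (∈-filter⁺ (λ x → ¬? (x ≟ˡ l)) x∈c₁ x≢l)
  from (inj₂ (x∈c₂ , x≢¬l)) =
    ∈-++⁺ʳ (filter (λ x → ¬? (x ≟ˡ l)) c₁) (∈-filter⁺ (λ x → ¬? (x ≟ˡ neg l)) x∈c₂ x≢¬l)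

resolventOn-Resolvent : ∀ {l c₁ c₂} → l ∈ c₁ → neg l ∈ c₂ → NonTaut (resolventOn l c₁ c₂) →
                        Resolvent c₁ c₂ (resolventOn l c₁ c₂)
resolventOn-Resolvent {l} {c₁} {c₂} l∈c₁ ¬l∈c₂ nt = l , l∈c₁ , ¬l∈c₂ , ∈-resolventOn l c₁ c₂ , nt

Robust : Assignment → Clause → Clause → Set
Robust a c r = Sat a r × (∀ l → l ∈ c → SatExcept a (neg l) r)

module _ {a : Assignment} {c : Clause} where

  Robust-transport : ∀ {r r′} → (∀ {m} → m ∈ r → Holds a m → m ∈ r′) → Robust a c r → Robust a c r′
  Robust-transport keep (sat , avoid) =
    Any-transport (λ m∈r h → keep m∈r h , h) sat ,
    λ l l∈c → Any-transport (λ m∈r (m≢¬l , h) → keep m∈r h , m≢¬l , h) (avoid l l∈c)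

  robust-resolvent : ∀ {r₁ r₂ r} → Robust a c r₁ → Robust a c r₂ → Resolvent r₁ r₂ r → Robust a c r
  robust-resolvent R₁ R₂ res with holds? a (pivot res)
  ... | yes h = Robust-transport (λ m∈r₂ hm → ∈-resolventʳ res m∈r₂ λ e →
                  holds⇒¬holds-neg (pivot res) h (subst (Holds a) e hm)) R₂
  ... | no ¬h = Robust-transport (λ m∈r₁ hm → ∈-resolventˡ res m∈r₁ λ e →
                  ¬h (subst (Holds a) e hm)) R₁

  robust-resolvent-≈ : ∀ {r₁ r₂ r} → r₁ ≈ c → Robust a c r₂ → Resolvent r₁ r₂ r → Robust a c r
  robust-resolvent-≈ {r₁} {r₂} {r} (r₁⊆c , c⊆r₁) (_ , avoid) res@(l , l∈r₁ , _ , _ , ntr) =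
    Any-transport (λ m∈r₂ (m≢¬l , h) → ∈-resolventʳ res m∈r₂ m≢¬l , h) avoid-¬l ,
    λ l′ l′∈c → Any-transport (survives l′∈c) avoid-¬l
    where
    avoid-¬l : SatExcept a (neg l) r₂
    avoid-¬l = avoid l (r₁⊆c l∈r₁)
    -- m = ¬l′ is impossible: l′ ≠ l would survive into r alongside ¬l′.
    survives : ∀ {l′ m} → l′ ∈ c → m ∈ r₂ → m ≢ neg l × Holds a m → m ∈ r × (m ≢ neg l′ × Holds a m)
    survives {l′} {m} l′∈c m∈r₂ (m≢¬l , h) = m∈r , m≢¬l′ , h
      where
      m∈r : m ∈ r
      m∈r = ∈-resolventʳ res m∈r₂ m≢¬l
      m≢¬l′ : m ≢ neg l′
      m≢¬l′ refl = ntr l′ (∈-resolventˡ res (c⊆r₁ l′∈c) λ e → m≢¬l (cong neg e)) m∈r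

  robust-step : ∀ {r₁ r₂ r} → NonTaut c → r₁ ≈ c ⊎ Robust a c r₁ → r₂ ≈ c ⊎ Robust a c r₂ →
                Resolvent r₁ r₂ r → Robust a c r
  robust-step ntc (inj₁ e₁) (inj₁ e₂) (l , l∈r₁ , ¬l∈r₂ , _) =
    ⊥-elim (ntc l (proj₁ e₁ l∈r₁) (proj₁ e₂ ¬l∈r₂))
  robust-step _ (inj₁ e₁) (inj₂ R₂) res = robust-resolvent-≈ e₁ R₂ res
  robust-step _ (inj₂ R₁) (inj₁ e₂) res = robust-resolvent-≈ e₂ R₁ (resolvent-sym res)
  robust-step _ (inj₂ R₁) (inj₂ R₂) res = robust-resolvent R₁ R₂ res

module Countermodel (F : Formula) (c : Clause) (wf : WF F) (c∈F : c ∈F F) (a : Assignment)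
  (satG : ∀ d → ((asSet F ∖｛ c ｝) ∪ resolve c F) d → Sat a d) (¬sat : ¬ Sat a c) where

  falsified : ∀ {m} → m ∈ c → ¬ Holds a m
  falsified m∈c h = ¬sat (lose m∈c h)

  robust-base : ∀ {r} → r ∈F F → ¬ r ≈ c → Robust a c r
  robust-base {r} r∈F r≉c = sat-r , avoid
    where
    sat-r : Sat a r
    sat-r = satG r (inj₁ (r∈F , r≉c))
    avoid : ∀ l → l ∈ c → SatExcept a (neg l) r
    avoid l l∈c with satExcept? a (neg l) r
    ... | yes s = s
    ... | no ¬s = Any-transport from-r (satG _ (inj₂ (r , r∈F , resolventOn-Resolvent l∈c ¬l∈r nt)))
      where
      ¬l∈r : neg l ∈ r
      ¬l∈r with find sat-r
      ... | m , m∈r , h with m ≟ˡ neg l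
      ...   | yes refl = m∈r
      ...   | no m≢¬l  = ⊥-elim (¬s (lose m∈r (m≢¬l , h)))
      nt : NonTaut (resolventOn l c r)
      nt x x∈ ¬x∈ with Equivalence.to (∈-resolventOn l c r x) x∈
                     | Equivalence.to (∈-resolventOn l c r (neg x)) ¬x∈
      ... | inj₁ (x∈c , _)    | inj₁ (¬x∈c , _)     = NonTaut-∈F wf c∈F x x∈c ¬x∈c
      ... | inj₁ (x∈c , _)    | inj₂ (¬x∈r , ¬x≢¬l) = ¬s (lose ¬x∈r (¬x≢¬l , ¬holds⇒holds-neg x (falsified x∈c)))
      ... | inj₂ (x∈r , x≢¬l) | inj₁ (¬x∈c , _)     = ¬s (lose x∈r (x≢¬l , ¬holds-neg⇒holds x (falsified ¬x∈c)))
      ... | inj₂ (x∈r , _)    | inj₂ (¬x∈r , _)     = NonTaut-∈F wf r∈F x x∈r ¬x∈r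
      from-r : ∀ {m} → m ∈ resolventOn l c r → Holds a m → m ∈ r × (m ≢ neg l × Holds a m)
      from-r {m} m∈ h with Equivalence.to (∈-resolventOn l c r m) m∈
      ... | inj₁ (m∈c , _)    = ⊥-elim (falsified m∈c h)
      ... | inj₂ (m∈r , m≢¬l) = m∈r , m≢¬l , h

  robust-ResCn : ∀ {r} → ResCn F r → r ≈ c ⊎ Robust a c r
  robust-ResCn {r} (base r∈F) with r ≈? c
  ... | yes r≈c = inj₁ r≈c
  ... | no r≉c  = inj₂ (robust-base r∈F r≉c)
  robust-ResCn (step d₁ d₂ res) =
    inj₂ (robust-step (NonTaut-∈F wf c∈F) (robust-ResCn d₁) (robust-ResCn d₂) res)

  sat-ResCn∖c : ∀ d → (ResCn F ∖｛ c ｝) d → Sat a d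
  sat-ResCn∖c d (d∈ , d≉c) with robust-ResCn d∈
  ... | inj₁ d≈c      = ⊥-elim (d≉c d≈c)
  ... | inj₂ (sat , _) = sat

lemma9 : (F : Formula) → (c : Clause) → WF F → c ∈F F →
    Superredundant F c ⇔ (((asSet F ∖｛ c ｝) ∪ resolve c F) ⊨ c)
lemma9 F c wf c∈F = mk⇔ to from
  where
  to : Superredundant F c → ((asSet F ∖｛ c ｝) ∪ resolve c F) ⊨ c
  to sr a satG with any? (holds? a) c
  ... | yes sat = sat
  ... | no ¬sat = sr a (Countermodel.sat-ResCn∖c F c wf c∈F a satG ¬sat)
  from : ((asSet F ∖｛ c ｝) ∪ resolve c F) ⊨ c → Superredundant F c
  from h a satR = h a λ where
    d (inj₁ (d∈F , d≉c)) → satR d (base d∈F , d≉c)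
    d (inj₂ (e , e∈F , res@(_ , l∈c , _))) →
      satR d ( step (base c∈F) (base e∈F) res
             , λ (_ , c⊆d) → pivot∉resolvent (NonTaut-∈F wf e∈F) res (c⊆d l∈c))
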